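{- An inversion sequence $a \in \mathcal{I}_n$ avoids the set of patterns $(102, 201, 210)$ if and only if it can be factored as either $p_1 \circ p_2$ or $p_1 \circ r_2$, where: \begin{itemize} \item $p_1$ is a non-decreasing inversion sequence such that $\max(p_1) < \max(a)$ (equivalently $p_1$ ends on a value below $\max(a)$), \item $p_2$ is a sequence of values from $\{\max(a),\;\mathrm{premax}(a)\}$, beginning on the value $\max(a)$, \item $r_2 = (\max(a), \ldots, \max(a), k, \ldots, k)$, where $0 \leq k < \mathrm{premax}(a)$, and $\max(a)$ and $k$ occur at least once. \end{itemize}
   Context: An inversion sequence of length $n$ is an integer sequence $(a_1,\dots,a_n)$ with $0 \le a_i < i$ for all $i$; $\mathcal{I}_n$ denotes the set of these, and avoidance of a set of patterns means no subsequence reduces to any of the patterns. For an inversion sequence $a$, $\max(a)$ is its greatest value and $\mathrm{premax}(a)$ (the premaximum) is its second-greatest distinct value. $\circ$ denotes concatenation. -}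

module Defs where

open import Data.Nat using (ℕ; zero; suc; _≤_; _<_; _⊔_; _<?_)
open import Data.Nat.Properties using (≤-totalOrder)
open import Data.Fin using (Fin; toℕ)
open import Data.List using (List; []; _∷_; length; lookup; foldr; filter; replicate; _++_)
open import Data.List.Relation.Unary.All using (All)
open import Data.List.Relation.Unary.Sorted.TotalOrder ≤-totalOrder using (Sorted)
open import Data.Maybe using (Maybe; just; nothing)
open import Data.Product using (Σ; _×_; ∃; ∃-syntax)
open import Data.Sum using (_⊎_)
open import Relation.Binary.PropositionalEquality using (_≡_)

-- An inversion sequence (a_1,...,a_n) with 0 ≤ a_i < i, represented as a list;
-- with 0-based positions i this is a[i] ≤ i.
IsInvSeq : List ℕ → Set
IsInvSeq a = (i : Fin (length a)) → lookup a i ≤ toℕ i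

Occurs : List ℕ → List ℕ → Set
Occurs p a =
  Σ (Fin (length p) → Fin (length a)) λ f →
    ((s t : Fin (length p)) → toℕ s < toℕ t → toℕ (f s) < toℕ (f t)) ×
    ((s t : Fin (length p)) →
       (lookup p s < lookup p t → lookup a (f s) < lookup a (f t)) ×
       (lookup a (f s) < lookup a (f t) → lookup p s < lookup p t))

Avoids : List ℕ → List (List ℕ) → Set
Avoids a ps = All (λ p → Occurs p a → Data.Empty.⊥) ps
  where import Data.Empty

-- greatest value (the maximum of the empty list is taken to be 0)
maxL : List ℕ → ℕ
maxL = foldr _⊔_ 0

premax : List ℕ → Maybe ℕ
premax a with filter (_<? maxL a) a
... | [] = nothing
... | b@(_ ∷ _) = just (maxL b)

GoodP1 : ℕ → List ℕ → Set
GoodP1 m p1 = IsInvSeq p1 × Sorted p1 × All (_< m) p1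

GoodP2 : ℕ → Maybe ℕ → List ℕ → Set
GoodP2 m pm p2 = Σ (List ℕ) λ rest → (p2 ≡ m ∷ rest) × All (λ v → (v ≡ m) ⊎ (just v ≡ pm)) rest

GoodR2 : ℕ → Maybe ℕ → List ℕ → Set
GoodR2 m pm r2 = ∃[ i ] ∃[ j ] ∃[ k ] ∃[ q ]
  (1 ≤ i) × (1 ≤ j) × (pm ≡ just q) × (k < q) × (r2 ≡ replicate i m ++ replicate j k)

Factors : List ℕ → Set
Factors a = ∃[ p1 ] ∃[ s ] (a ≡ p1 ++ s) × GoodP1 (maxL a) p1 ×
  (GoodP2 (maxL a) (premax a) s ⊎ GoodR2 (maxL a) (premax a) s)

pats : List (List ℕ)
pats = (1 ∷ 0 ∷ 2 ∷ []) ∷ (2 ∷ 0 ∷ 1 ∷ []) ∷ (2 ∷ 1 ∷ 0 ∷ []) ∷ []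

{-# OPTIONS --safe #-}
-- A subsequence x y z is forbidden when y < x and z ∉ {x, y}; according as z lies above x,
-- between y and x, or below y, these are exactly the occurrences of 102, 201 and 210.
-- In p₁ ∘ p₂ or p₁ ∘ r₂ a descent cannot begin and end in the sorted prefix p₁, so y and z
-- lie in the suffix: in r₂ they would be equal, and in p₂ they would be premax and max,
-- leaving x strictly between the two.
-- Conversely, cut a at the first occurrence of m = max a. A descent before m is forbidden
-- with m as third entry, so the prefix is sorted; m followed by two distinct values below m
-- is forbidden, so after m only one value k < m occurs. If k is not the premaximum q, then
-- k < q, q lies in the prefix, and q k m rules out any m after k: the suffix is m…m k…k.
module Submission where

open import Defs
open import Data.Empty using (⊥)
open import Data.Fin as Fin using (Fin; toℕ; lift; inject≤; #_)
open import Data.Fin.Properties using (toℕ-inject≤)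
open import Data.List using (List; []; _∷_; length; _++_; map; replicate; tabulate; lookup; filter)
open import Data.List.Membership.Propositional using (_∈_; _∉_; find)
open import Data.List.Membership.Propositional.Properties
  using (∈-filter⁺; ∈-filter⁻; foldr-selective; ∈-++⁺ˡ; ∈-++⁺ʳ; ∈-++⁻)
open import Data.List.Properties using (map-id; foldr-forcesᵇ; length-++)
open import Data.List.Relation.Binary.Sublist.Heterogeneous using (Sublist; []; _∷_; _∷ʳ_)
open import Data.List.Relation.Binary.Sublist.Heterogeneous.Properties using (map⁻)
open import Data.List.Relation.Binary.Sublist.Propositional using (_⊆_; _⊈_; minimum; from∈; to∈)
open import Data.List.Relation.Binary.Sublist.Propositional.Properties using (∷ˡ⁻; ++⁺; ++⁺ˡ)
open import Data.List.Relation.Unary.All as All using (All; []; _∷_; all?)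
open import Data.List.Relation.Unary.All.Properties using (¬All⇒Any¬)
open import Data.List.Relation.Unary.AllPairs using (AllPairs; _∷_)
open import Data.List.Relation.Unary.Any using (here; there)
open import Data.List.Relation.Unary.Linked using (Linked; []; [-]; _∷_)
open import Data.List.Relation.Unary.Linked.Properties using (Linked⇒AllPairs)
open import Data.Maybe using (just)
open import Data.Maybe.Properties using (just-injective; ≡-dec)
open import Data.Nat using (ℕ; zero; suc; _+_; _≤_; _<_; _≟_; _≤?_; _<?_; z≤n; s≤s; z<s; s<s; s≤s⁻¹; s<s⁻¹)
open import Data.Nat.Properties
  using (≤-totalOrder; ≤-trans; ≤-refl; <-trans; <-≤-trans; ≤-<-trans; <-irrefl; <-asym; <-cmp;
         <⇒≢; >⇒≢; <⇒≱; ≰⇒>; ≤∧≢⇒<; n≤0⇒n≡0; m≤m+n; m≤n+m; +-monoˡ-<; ⊔-sel; m⊔n≤o⇒m≤o; m⊔n≤o⇒n≤o)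
open import Data.List.Relation.Unary.Sorted.TotalOrder ≤-totalOrder using (Sorted)
open import Data.Product using (Σ; ∃; ∃-syntax; ∃₂; _×_; _,_; proj₁; proj₂)
open import Data.Sum as Sum using (_⊎_; inj₁; inj₂)
open import Function using (_∘_; id)
open import Function.Bundles using (_⇔_; mk⇔)
open import Relation.Binary using (tri<; tri≈; tri>)
open import Relation.Binary.Definitions using (DecidableEquality)
open import Relation.Binary.PropositionalEquality using (_≡_; _≢_; refl; sym; trans; cong; subst; subst₂)
open import Relation.Nullary using (¬_; Dec; yes; no; contradiction)
open import Relation.Nullary.Decidable using (_⊎-dec_; decidable-stable; toSum)

StrictlyIncreasing : ∀ {m n} → (Fin m → Fin n) → Set
StrictlyIncreasing f = ∀ s t → s Fin.< t → f s Fin.< f t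

lift-increasing : ∀ {m n} {f : Fin m → Fin n} → StrictlyIncreasing f → StrictlyIncreasing (lift 1 f)
lift-increasing f↑ Fin.zero (Fin.suc t) _ = z<s
lift-increasing f↑ (Fin.suc s) (Fin.suc t) s<t = s<s (f↑ s t (s<s⁻¹ s<t))

unsuc : ∀ {n} (j : Fin (suc n)) → 0 < toℕ j → ∃[ k ] j ≡ Fin.suc k
unsuc (Fin.suc k) _ = k , refl

pred-increasing : ∀ {m n} (f : Fin m → Fin (suc n)) → StrictlyIncreasing f → (∀ i → 0 < toℕ (f i)) →
  Σ (Fin m → Fin n) λ f⁻ → StrictlyIncreasing f⁻ × ∀ i → f i ≡ Fin.suc (f⁻ i)
pred-increasing {m} {n} f f↑ f>0 = f⁻ , f⁻↑ , f≡
  where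
  f⁻ : Fin m → Fin n
  f⁻ i = proj₁ (unsuc (f i) (f>0 i))
  f≡ : ∀ i → f i ≡ Fin.suc (f⁻ i)
  f≡ i = proj₂ (unsuc (f i) (f>0 i))
  f⁻↑ : StrictlyIncreasing f⁻
  f⁻↑ s t s<t = s<s⁻¹ (subst₂ Fin._<_ (f≡ s) (f≡ t) (f↑ s t s<t))

module _ {A B : Set} {R : A → B → Set} where

  ⊆⇒increasing : ∀ {xs ys} → Sublist R xs ys →
    Σ (Fin (length xs) → Fin (length ys)) λ f →
      StrictlyIncreasing f × ∀ i → R (lookup xs i) (lookup ys (f i))
  ⊆⇒increasing [] = (λ ()) , (λ ()) , (λ ())
  ⊆⇒increasing (y ∷ʳ τ) =
    let f , f↑ , f-R = ⊆⇒increasing τ in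
    Fin.suc ∘ f , (λ s t s<t → s<s (f↑ s t s<t)) , f-R
  ⊆⇒increasing (r ∷ τ) =
    let f , f↑ , f-R = ⊆⇒increasing τ in
    lift 1 f , lift-increasing f↑ , λ { Fin.zero → r ; (Fin.suc i) → f-R i }

module _ {A : Set} where

  increasing⇒⊆ : ∀ {n} (ys : List A) (f : Fin n → Fin (length ys)) (g : Fin n → A) →
    StrictlyIncreasing f → (∀ i → g i ≡ lookup ys (f i)) → tabulate g ⊆ ys
  increasing⇒⊆-tail : ∀ {n} y (ys : List A) (f : Fin n → Fin (length (y ∷ ys))) (g : Fin n → A) →
    StrictlyIncreasing f → (∀ i → g i ≡ lookup (y ∷ ys) (f i)) → (∀ i → 0 < toℕ (f i)) →
    tabulate g ⊆ ys

  increasing⇒⊆ {zero} ys f g f↑ g≡ = minimum ys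
  increasing⇒⊆ {suc n} [] f g f↑ g≡ with f Fin.zero
  ... | ()
  increasing⇒⊆ {suc n} (y ∷ ys) f g f↑ g≡ with f Fin.zero in f0≡
  ... | Fin.zero =
    trans (g≡ Fin.zero) (cong (lookup (y ∷ ys)) f0≡) ∷
    increasing⇒⊆-tail y ys (f ∘ Fin.suc) (g ∘ Fin.suc) (λ s t → f↑ (Fin.suc s) (Fin.suc t) ∘ s<s) (g≡ ∘ Fin.suc)
      λ i → subst (λ j → toℕ j < toℕ (f (Fin.suc i))) f0≡ (f↑ Fin.zero (Fin.suc i) z<s)
  ... | Fin.suc _ =
    y ∷ʳ increasing⇒⊆-tail y ys f g f↑ g≡ λ
      { Fin.zero → subst (λ j → 0 < toℕ j) (sym f0≡) z<s
      ; (Fin.suc i) → ≤-<-trans z≤n (f↑ Fin.zero (Fin.suc i) z<s)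
      }

  increasing⇒⊆-tail y ys f g f↑ g≡ f>0 =
    let f⁻ , f⁻↑ , f≡ = pred-increasing f f↑ f>0 in
    increasing⇒⊆ ys f⁻ g f⁻↑ λ i → trans (g≡ i) (cong (lookup (y ∷ ys)) (f≡ i))

  ∈-ordered : ∀ {u w : A} {l} → u ∈ l → w ∈ l → u ≡ w ⊎ u ∷ w ∷ [] ⊆ l ⊎ w ∷ u ∷ [] ⊆ l
  ∈-ordered (here refl) (here refl) = inj₁ refl
  ∈-ordered (here refl) (there w∈l) = inj₂ (inj₁ (refl ∷ from∈ w∈l))
  ∈-ordered (there u∈l) (here refl) = inj₂ (inj₂ (refl ∷ from∈ u∈l))
  ∈-ordered (there u∈l) (there w∈l) = Sum.map₂ (Sum.map (_ ∷ʳ_) (_ ∷ʳ_)) (∈-ordered u∈l w∈l)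

  pairs⇒Linked : ∀ {R : A → A → Set} {l} → (∀ {x y} → x ∷ y ∷ [] ⊆ l → R x y) → Linked R l
  pairs⇒Linked {l = []} _ = []
  pairs⇒Linked {l = x ∷ []} _ = [-]
  pairs⇒Linked {l = x ∷ y ∷ l} R-pairs = R-pairs (refl ∷ refl ∷ minimum l) ∷ pairs⇒Linked (R-pairs ∘ (x ∷ʳ_))

  ⊆-replicate : ∀ {xs n} {v : A} → xs ⊆ replicate n v → All (_≡ v) xs
  ⊆-replicate {n = zero} [] = []
  ⊆-replicate {n = suc n} (_ ∷ʳ τ) = ⊆-replicate τ
  ⊆-replicate {n = suc n} (x≡v ∷ τ) = x≡v ∷ ⊆-replicate τ

  replicate-of-∉ : ∀ {m v : A} {l} → m ∉ l → All (λ w → w ≡ m ⊎ w ≡ v) l → l ≡ replicate (length l) v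
  replicate-of-∉ m∉l [] = refl
  replicate-of-∉ m∉l (inj₁ refl ∷ _) = contradiction (here refl) m∉l
  replicate-of-∉ m∉l (inj₂ refl ∷ vals) = cong (_ ∷_) (replicate-of-∉ (m∉l ∘ there) vals)

  blocks-shape : ∀ {m v : A} {l} → m ≢ v → v ∈ l → All (λ w → w ≡ m ⊎ w ≡ v) l → v ∷ m ∷ [] ⊈ l →
    ∃₂ λ i j → l ≡ replicate i m ++ replicate (suc j) v
  blocks-shape {l = _ ∷ l} m≢v _ (inj₂ refl ∷ vals) v⋯m =
    0 , length l , cong (_ ∷_) (replicate-of-∉ (λ m∈l → v⋯m (refl ∷ from∈ m∈l)) vals)
  blocks-shape m≢v (here v≡m) (inj₁ refl ∷ _) _ = contradiction (sym v≡m) m≢v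
  blocks-shape m≢v (there v∈l) (inj₁ refl ∷ vals) v⋯m =
    let i , j , l≡ = blocks-shape m≢v v∈l vals (v⋯m ∘ (_ ∷ʳ_)) in
    suc i , j , cong (_ ∷_) l≡

  split-at-first : DecidableEquality A → ∀ {x} xs → x ∈ xs → ∃₂ λ p s → xs ≡ p ++ x ∷ s × All (_≢ x) p
  split-at-first _≟ᴬ_ {x} (y ∷ xs) x∈ with y ≟ᴬ x | x∈
  ... | yes refl | _ = [] , xs , refl , []
  ... | no y≢x | here x≡y = contradiction (sym x≡y) y≢x
  ... | no y≢x | there x∈xs =
    let p , s , xs≡ , ≢x = split-at-first _≟ᴬ_ xs x∈xs in
    y ∷ p , s , cong (y ∷_) xs≡ , y≢x ∷ ≢x

  lookup-++-inject≤ : ∀ (xs ys : List A) i .(le : length xs ≤ length (xs ++ ys)) →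
    lookup (xs ++ ys) (inject≤ i le) ≡ lookup xs i
  lookup-++-inject≤ (x ∷ xs) ys Fin.zero le = refl
  lookup-++-inject≤ (x ∷ xs) ys (Fin.suc i) le = lookup-++-inject≤ xs ys i (s≤s⁻¹ le)

IsInvSeq-++⁻ˡ : ∀ p s → IsInvSeq (p ++ s) → IsInvSeq p
IsInvSeq-++⁻ˡ p s inv i = subst₂ _≤_ (lookup-++-inject≤ p s i le) (toℕ-inject≤ i le) (inv (inject≤ i le))
  where
  le : length p ≤ length (p ++ s)
  le = subst (length p ≤_) (sym (length-++ p)) (m≤m+n _ _)

maxL-upper : ∀ {v l} → v ∈ l → v ≤ maxL l
maxL-upper {l = l} = All.lookup (foldr-forcesᵇ (λ x y ⊔≤ → m⊔n≤o⇒m≤o x y ⊔≤ , m⊔n≤o⇒n≤o x y ⊔≤) 0 l ≤-refl)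

maxL-∈ : ∀ {v l} → v ∈ l → maxL l ∈ l
maxL-∈ {v} {l} v∈l with foldr-selective ⊔-sel 0 l
... | inj₂ max∈l = max∈l
... | inj₁ max≡0 = subst (_∈ l) (trans (n≤0⇒n≡0 (subst (v ≤_) max≡0 (maxL-upper v∈l))) (sym max≡0)) v∈l

record IsPremax (a : List ℕ) (q : ℕ) : Set where
  field
    premax≡   : premax a ≡ just q
    member    : q ∈ a
    below-max : q < maxL a
    greatest  : ∀ {w} → w ∈ a → w < maxL a → w ≤ q

premax≡maxL-below : ∀ {a x xs} → filter (_<? maxL a) a ≡ x ∷ xs → premax a ≡ just (maxL (x ∷ xs))
premax≡maxL-below {a} below≡ with filter (_<? maxL a) a
premax≡maxL-below refl | _ = refl

premax-exists : ∀ {v a} → v ∈ a → v < maxL a → ∃ (IsPremax a)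
premax-exists {v} {a} v∈a v<max with filter (_<? maxL a) a in below≡ | ∈-filter⁺ (_<? maxL a) v∈a v<max
... | [] | ()
... | x ∷ xs | v∈below = maxL (x ∷ xs) , record
  { premax≡   = premax≡maxL-below {a} below≡
  ; member    = proj₁ (below⁻ (maxL-∈ v∈below))
  ; below-max = proj₂ (below⁻ (maxL-∈ v∈below))
  ; greatest  = λ w∈a w<max → maxL-upper (subst (_ ∈_) below≡ (∈-filter⁺ (_<? maxL a) w∈a w<max))
  }
  where
  below⁻ : ∀ {w} → w ∈ x ∷ xs → w ∈ a × w < maxL a
  below⁻ w∈ = ∈-filter⁻ (_<? maxL a) (subst (_ ∈_) (sym below≡) w∈)

-- Strictly increasing on all of ℕ, so mapping a pattern over {0, 1, 2} through it keeps its order type.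
increasing₃ : ℕ → ℕ → ℕ → ℕ → ℕ
increasing₃ u₀ u₁ u₂ 0 = u₀
increasing₃ u₀ u₁ u₂ 1 = u₁
increasing₃ u₀ u₁ u₂ (suc (suc k)) = k + u₂

increasing₃-mono : ∀ {u₀ u₁ u₂} → u₀ < u₁ → u₁ < u₂ →
  ∀ {i j} → i < j → increasing₃ u₀ u₁ u₂ i < increasing₃ u₀ u₁ u₂ j
increasing₃-mono u₀<u₁ u₁<u₂ {0} {1} _ = u₀<u₁
increasing₃-mono u₀<u₁ u₁<u₂ {0} {suc (suc j)} _ = <-trans u₀<u₁ (<-≤-trans u₁<u₂ (m≤n+m _ j))
increasing₃-mono u₀<u₁ u₁<u₂ {1} {suc (suc j)} _ = <-≤-trans u₁<u₂ (m≤n+m _ j)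
increasing₃-mono u₀<u₁ u₁<u₂ {suc (suc i)} {suc (suc j)} i<j = +-monoˡ-< _ (s<s⁻¹ (s<s⁻¹ i<j))
increasing₃-mono u₀<u₁ u₁<u₂ {1} {1} (s<s ())
increasing₃-mono u₀<u₁ u₁<u₂ {suc (suc i)} {1} (s<s ())

⊆⇒Occurs : ∀ {p a} (g : ℕ → ℕ) → (∀ {i j} → i < j → g i < g j) → map g p ⊆ a → Occurs p a
⊆⇒Occurs {p} {a} g g↑ τ =
  let f , f↑ , g≡ = ⊆⇒increasing (map⁻ g id (subst (map g p ⊆_) (sym (map-id a)) τ)) in
  f , f↑ , λ s t → (λ lt → subst₂ _<_ (g≡ s) (g≡ t) (g↑ lt))
                 , (λ lt → g-reflects (subst₂ _<_ (sym (g≡ s)) (sym (g≡ t)) lt))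
  where
  g-reflects : ∀ {i j} → g i < g j → i < j
  g-reflects {i} {j} gi<gj with <-cmp i j
  ... | tri< i<j _ _ = i<j
  ... | tri≈ _ refl _ = contradiction gi<gj (<-irrefl refl)
  ... | tri> _ _ j<i = contradiction gi<gj (<-asym (g↑ j<i))

Forbidden : ℕ → ℕ → ℕ → Set
Forbidden x y z = y < x × y ≢ z × x ≢ z

ForbiddenFree : List ℕ → Set
ForbiddenFree a = ∀ {x y z} → x ∷ y ∷ z ∷ [] ⊆ a → ¬ Forbidden x y z

Avoids⇒ForbiddenFree : ∀ {a} → Avoids a pats → ForbiddenFree a
Avoids⇒ForbiddenFree (¬102 ∷ ¬201 ∷ ¬210 ∷ []) {x} {y} {z} τ (y<x , y≢z , x≢z) with <-cmp x z | <-cmp y z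
... | tri< x<z _ _ | _ = ¬102 (⊆⇒Occurs (increasing₃ y x z) (increasing₃-mono y<x x<z) τ)
... | tri≈ _ x≡z _ | _ = x≢z x≡z
... | tri> _ _ z<x | tri< y<z _ _ = ¬201 (⊆⇒Occurs (increasing₃ y z x) (increasing₃-mono y<z z<x) τ)
... | tri> _ _ _ | tri≈ _ y≡z _ = y≢z y≡z
... | tri> _ _ _ | tri> _ _ z<y = ¬210 (⊆⇒Occurs (increasing₃ z y x) (increasing₃-mono z<y y<x) τ)

≢-preserved : ∀ {u v u′ v′} → (u < v → u′ < v′) → (v < u → v′ < u′) → u ≢ v → u′ ≢ v′
≢-preserved {u} {v} lt gt u≢v with <-cmp u v
... | tri< u<v _ _ = <⇒≢ (lt u<v)
... | tri≈ _ u≡v _ = contradiction u≡v u≢v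
... | tri> _ _ v<u = >⇒≢ (gt v<u)

ForbiddenFree⇒¬Occurs : ∀ {p₀ p₁ p₂ a} → ForbiddenFree a → Forbidden p₀ p₁ p₂ → ¬ Occurs (p₀ ∷ p₁ ∷ p₂ ∷ []) a
ForbiddenFree⇒¬Occurs {p₀} {p₁} {p₂} {a} free (p₁<p₀ , p₁≢p₂ , p₀≢p₂) (f , f↑ , iso) =
  free (increasing⇒⊆ a f _ f↑ λ _ → refl)
       (order (# 1) (# 0) p₁<p₀ , ≢-preserved (order (# 1) (# 2)) (order (# 2) (# 1)) p₁≢p₂
                               , ≢-preserved (order (# 0) (# 2)) (order (# 2) (# 0)) p₀≢p₂)
  where
  order : ∀ s t → lookup (p₀ ∷ p₁ ∷ p₂ ∷ []) s < lookup (p₀ ∷ p₁ ∷ p₂ ∷ []) t → lookup a (f s) < lookup a (f t)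
  order s t = proj₁ (iso s t)

ForbiddenFree⇒Avoids : ∀ {a} → ForbiddenFree a → Avoids a pats
ForbiddenFree⇒Avoids free =
  ForbiddenFree⇒¬Occurs free (z<s , (λ ()) , (λ ())) ∷
  ForbiddenFree⇒¬Occurs free (z<s , (λ ()) , (λ ())) ∷
  ForbiddenFree⇒¬Occurs free (s<s z<s , (λ ()) , (λ ())) ∷ []

⊆-++-below : ∀ {h y ys p s} → All (h ≤_) p → y < h → y ∷ ys ⊆ p ++ s → y ∷ ys ⊆ s
⊆-++-below {p = []} _ _ τ = τ
⊆-++-below {p = _ ∷ _} (_ ∷ h≤p) y<h (_ ∷ʳ τ) = ⊆-++-below h≤p y<h τ
⊆-++-below {p = _ ∷ _} (h≤y ∷ _) y<h (refl ∷ _) = contradiction h≤y (<⇒≱ y<h)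

descent-⊆-suffix : ∀ {x y ys p s} → AllPairs _≤_ p → y < x → x ∷ y ∷ ys ⊆ p ++ s → y ∷ ys ⊆ s
descent-⊆-suffix {p = []} _ _ τ = ∷ˡ⁻ τ
descent-⊆-suffix {p = _ ∷ _} (_ ∷ sorted) y<x (_ ∷ʳ τ) = descent-⊆-suffix sorted y<x τ
descent-⊆-suffix {p = _ ∷ _} (x≤p ∷ _) y<x (refl ∷ τ) = ⊆-++-below x≤p y<x τ

⊆-blocks⇒≡ : ∀ {y z m k : ℕ} i j → y ∷ z ∷ [] ⊆ replicate i m ++ replicate j k → y ≢ m → y ≡ z
⊆-blocks⇒≡ zero j τ _ with ⊆-replicate τ
... | y≡k ∷ z≡k ∷ [] = trans y≡k (sym z≡k)
⊆-blocks⇒≡ (suc i) j (_ ∷ʳ τ) y≢m = ⊆-blocks⇒≡ i j τ y≢m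
⊆-blocks⇒≡ (suc i) j (refl ∷ _) y≢m = contradiction refl y≢m

Factors⇒ForbiddenFree : ∀ {a} → Factors a → ForbiddenFree a
Factors⇒ForbiddenFree {a} (p , s , a≡ , (_ , p-sorted , _) , suffix) {x} {y} {z} τ (y<x , y≢z , x≢z) =
  contradict-suffix suffix
  where
  yz⊆s : y ∷ z ∷ [] ⊆ s
  yz⊆s = descent-⊆-suffix (Linked⇒AllPairs ≤-trans p-sorted) y<x (subst (_ ⊆_) a≡ τ)
  x≤max : x ≤ maxL a
  x≤max = maxL-upper (to∈ τ)
  y≢max : y ≢ maxL a
  y≢max = <⇒≢ (<-≤-trans y<x x≤max)
  contradict-suffix : GoodP2 (maxL a) (premax a) s ⊎ GoodR2 (maxL a) (premax a) s → ⊥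
  contradict-suffix (inj₂ (i , j , _ , _ , _ , _ , _ , _ , s≡)) = y≢z (⊆-blocks⇒≡ i j (subst (_ ⊆_) s≡ yz⊆s) y≢max)
  contradict-suffix (inj₁ (rest , s≡ , rest-values)) = contradict-values (subst (All _) (sym s≡) (inj₁ refl ∷ rest-values))
    where
    contradict-values : All (λ v → v ≡ maxL a ⊎ just v ≡ premax a) s → ⊥
    contradict-values values with All.lookup values (to∈ yz⊆s) | All.lookup values (to∈ (∷ˡ⁻ yz⊆s))
    ... | inj₁ y≡max | _ = y≢max y≡max
    ... | inj₂ y-pre | inj₂ z-pre = y≢z (just-injective (trans y-pre (sym z-pre)))
    ... | inj₂ y-pre | inj₁ z≡max =
      let q , q-premax = premax-exists (to∈ τ) x<max
          open IsPremax q-premax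
      in contradiction (subst (x ≤_) (just-injective (trans (sym premax≡) (sym y-pre))) (greatest (to∈ τ) x<max)) (<⇒≱ y<x)
      where
      x<max : x < maxL a
      x<max = ≤∧≢⇒< x≤max (x≢z ∘ λ x≡max → trans x≡max (sym z≡max))

prefix-sorted : ∀ {p z s} → ForbiddenFree (p ++ z ∷ s) → All (_< z) p → Sorted p
prefix-sorted {p} {z} {s} free p<z = pairs⇒Linked ordered
  where
  ordered : ∀ {x y} → x ∷ y ∷ [] ⊆ p → x ≤ y
  ordered {x} {y} xy⊆p with x ≤? y
  ... | yes x≤y = x≤y
  ... | no x≰y = contradiction (≰⇒> x≰y , <⇒≢ y<z , <⇒≢ x<z) (free (++⁺ xy⊆p (refl ∷ minimum s)))
    where
    x<z : x < z
    x<z = All.lookup p<z (to∈ xy⊆p)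
    y<z : y < z
    y<z = All.lookup p<z (to∈ (∷ˡ⁻ xy⊆p))

suffix-below-constant : ∀ {p z s u w} → ForbiddenFree (p ++ z ∷ s) → u ∈ s → w ∈ s → u < z → w < z → u ≡ w
suffix-below-constant {p} {u = u} {w} free u∈s w∈s u<z w<z with ∈-ordered u∈s w∈s
... | inj₁ u≡w = u≡w
... | inj₂ (inj₁ uw⊆s) = decidable-stable (u ≟ w) λ u≢w →
  free (++⁺ˡ p (refl ∷ uw⊆s)) (u<z , u≢w , >⇒≢ w<z)
... | inj₂ (inj₂ wu⊆s) = decidable-stable (u ≟ w) λ u≢w →
  free (++⁺ˡ p (refl ∷ wu⊆s)) (w<z , u≢w ∘ sym , >⇒≢ u<z)

module SplitAtMax {a p r} (free : ForbiddenFree a) (a≡ : a ≡ p ++ maxL a ∷ r) where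

  private
    m : ℕ
    m = maxL a

    free′ : ForbiddenFree (p ++ m ∷ r)
    free′ = subst ForbiddenFree a≡ free

    ∈-suffix : ∀ {w} → w ∈ r → w ∈ a
    ∈-suffix w∈r = subst (_ ∈_) (sym a≡) (∈-++⁺ʳ p (there w∈r))

    ≢max⇒<max : ∀ {w} → w ∈ a → w ≢ m → w < m
    ≢max⇒<max w∈a = ≤∧≢⇒< (maxL-upper w∈a)

  prefix-good : IsInvSeq a → All (_≢ m) p → GoodP1 m p
  prefix-good inv m∉p = IsInvSeq-++⁻ˡ p _ (subst IsInvSeq a≡ inv) , prefix-sorted free′ p<m , p<m
    where
    p<m : All (_< m) p
    p<m = All.tabulate λ w∈p → ≢max⇒<max (subst (_ ∈_) (sym a≡) (∈-++⁺ˡ w∈p)) (All.lookup m∉p w∈p)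

  blocks-suffix : ∀ {v} → v ∈ r → v ≢ m → just v ≢ premax a → GoodR2 m (premax a) (m ∷ r)
  blocks-suffix {v} v∈r v≢m v≢premax =
    let i , j , r≡ = blocks-shape (v≢m ∘ sym) v∈r r-values m-after-v-forbidden in
    suc i , suc j , v , q , s≤s z≤n , s≤s z≤n , premax≡ , v<q , cong (m ∷_) r≡
    where
    v<m : v < m
    v<m = ≢max⇒<max (∈-suffix v∈r) v≢m
    q-premax : ∃ (IsPremax a)
    q-premax = premax-exists (∈-suffix v∈r) v<m
    q : ℕ
    q = proj₁ q-premax
    open IsPremax (proj₂ q-premax)
    v<q : v < q
    v<q = ≤∧≢⇒< (greatest (∈-suffix v∈r) v<m) λ v≡q → v≢premax (trans (cong just v≡q) (sym premax≡))
    below-max-is-v : ∀ {w} → w ∈ r → w < m → w ≡ v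
    below-max-is-v w∈r w<m = suffix-below-constant free′ w∈r v∈r w<m v<m
    r-values : All (λ w → w ≡ m ⊎ w ≡ v) r
    r-values = All.tabulate λ {w} w∈r → Sum.map₂ (below-max-is-v w∈r ∘ ≢max⇒<max (∈-suffix w∈r)) (toSum (w ≟ m))
    q∈p : q ∈ p
    q∈p with ∈-++⁻ p (subst (q ∈_) a≡ member)
    ... | inj₁ q∈p = q∈p
    ... | inj₂ (here q≡m) = contradiction q≡m (<⇒≢ below-max)
    ... | inj₂ (there q∈r) = contradiction (below-max-is-v q∈r below-max) (>⇒≢ v<q)
    m-after-v-forbidden : v ∷ m ∷ [] ⊈ r
    m-after-v-forbidden vm⊆r = free′ (++⁺ (from∈ q∈p) (m ∷ʳ vm⊆r)) (v<q , <⇒≢ v<m , <⇒≢ below-max)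

  value? : ∀ w → Dec (w ≡ m ⊎ just w ≡ premax a)
  value? w = w ≟ m ⊎-dec ≡-dec _≟_ (just w) (premax a)

  suffix-good : GoodP2 m (premax a) (m ∷ r) ⊎ GoodR2 m (premax a) (m ∷ r)
  suffix-good with all? value? r
  ... | yes r-values = inj₁ (r , refl , r-values)
  ... | no ¬r-values =
    let v , v∈r , v-other = find (¬All⇒Any¬ value? r ¬r-values) in
    inj₂ (blocks-suffix v∈r (v-other ∘ inj₁) (v-other ∘ inj₂))

ForbiddenFree⇒Factors : ∀ {a} → IsInvSeq a → 1 ≤ length a → ForbiddenFree a → Factors a
ForbiddenFree⇒Factors {[]} _ () _
ForbiddenFree⇒Factors {a₀ ∷ as} inv _ free =
  let p , r , a≡ , max∉p = split-at-first _≟_ (a₀ ∷ as) (maxL-∈ (here refl)) in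
  p , _ ∷ r , a≡ , SplitAtMax.prefix-good free a≡ inv max∉p , SplitAtMax.suffix-good free a≡

mainTheorem10 : (a : List ℕ) → IsInvSeq a → 1 ≤ length a →
    (Avoids a pats ⇔ Factors a)
mainTheorem10 a inv nonempty = mk⇔
  (ForbiddenFree⇒Factors inv nonempty ∘ Avoids⇒ForbiddenFree)
  (ForbiddenFree⇒Avoids ∘ Factors⇒ForbiddenFree)
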